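{- Let $\mathcal{A}=(Q,E,s,F)$ be a Wheeler $r$-GNFA (possibly with $\epsilon$-transitions), let $\le$ be a Wheeler order on $\mathcal{A}$, and let $\alpha\in\Sigma^*$ with $\alpha\neq\epsilon$. For $0<k<\min\{r+1,|\alpha|\}$ let $f_k=\mathtt{out}(Q[1,|G^\prec(p(\alpha,|\alpha|-k))|],s(\alpha,k))$. Let $j^*$ be the largest integer $0\le j\le|Q|$ such that: (i) $\mathtt{in}(Q[1,j],s(\alpha,k))\le f_k$ for every $0<k<\min\{r+1,|\alpha|\}$; and (ii) $\rho\prec\alpha$ for every $\rho\in\Sigma^k\cap\lambda(Q[h])$, for every $1\le h\le j$ and every $0<k<r+1$. Then $|G^\prec(\alpha)|$ is the largest integer $0\le t\le j^*$ such that, if $t\ge1$, then $A_{\max}[t]=t$.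
   Context: $\Sigma$ is a finite alphabet with a fixed total order $\preceq$, extended co-lexicographically to $\Sigma^*$ (compare reversed strings lexicographically); $\Sigma^k$ is the set of strings of length $k$; $\epsilon$ is the empty string; $\alpha\dashv\beta$ means $\alpha$ is a suffix of $\beta$; $p(\alpha,k)$ and $s(\alpha,k)$ denote the prefix and suffix of $\alpha$ of length $k$. A GNFA is $\mathcal{A}=(Q,E,s,F)$ with finite state set $Q$, finite edge set $E\subseteq Q\times Q\times\Sigma^*$ (labels may be $\epsilon$), initial state $s$, final states $F$; every state is reachable from $s$ and is final or can reach a final state. It is an $r$-GNFA if every label has length at most $r$. $I_u$ is the set of strings $\alpha_1\cdots\alpha_{t-1}$ with states $u_1=s,\dots,u_t=u$ ($t\ge1$), $(u_i,u_{i+1},\alpha_i)\in E$. $u\preceq_{\mathcal{A}}v$ iff for all $\alpha\in I_u,\beta\in I_v$ with $\{\alpha,\beta\}\not\subseteq I_u\cap I_v$, $\alpha\prec\beta$. A Wheeler order is a total order $\le$ on $Q$ with: (1) $u\le v\Rightarrow u\preceq_{\mathcal{A}}v$; (2) $s$ is $\le$-minimum; (3) for $(u',u,\rho),(v',v,\rho')\in E$, if $u<v$ and $\rho'$ is not a strict suffix of $\rho$ then $\rho\preceq\rho'$; (4) for $(u',u,\rho),(v',v,\rho)\in E$, $u<v\Rightarrow u'\le v'$. Write $Q[1]<\dots<Q[|Q|]$ for the states in order, $Q[i,j]=\{Q[i],\dots,Q[j]\}$ ($\emptyset$ if $i>j$). For $U\subseteq Q$ and $\rho\in\Sigma^*$,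 $\mathtt{out}(U,\rho)$ (resp. $\mathtt{in}(U,\rho)$) is the number of edges labeled $\rho$ leaving (resp. entering) states of $U$. $\lambda(u)$ is the set of labels of edges entering $u$. $G^\prec(\alpha)=\{u\in Q:\forall\beta\in I_u,\ \beta\prec\alpha\}$. An $\epsilon$-walk from $u$ to $v$ is a sequence $z_1=u,\dots,z_t=v$ ($t\ge1$) with $(z_i,z_{i+1},\epsilon)\in E$; there is always an $\epsilon$-walk from $u$ to $u$. $A_{\max}[i]$ is the largest $1\le j\le|Q|$ such that there is an $\epsilon$-walk from $Q[j]$ to $Q[i]$. -}

module Defs where

open import Level using (0ℓ)
open import Data.Nat as ℕ using (ℕ; zero; suc; _≤_; _<_; _∸_; _⊔_)
open import Data.Fin as Fin using (Fin; toℕ)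
open import Data.Fin.Properties as FinP using ()
open import Data.List using (List; []; _∷_; _++_; length; reverse; take; drop; filter)
open import Data.List.Properties using (≡-dec)
open import Data.List.Membership.Propositional using (_∈_)
open import Data.List.Relation.Unary.Unique.Propositional using (Unique)
open import Data.Product using (Σ; ∃; _×_; _,_)
open import Data.Sum using (_⊎_)
open import Relation.Binary.PropositionalEquality using (_≡_; _≢_)
open import Relation.Nullary using (¬_; Dec; yes; no)
open import Relation.Nullary.Decidable using (_×-dec_)
open import Function.Definitions using (Injective)
open import Function.Bundles using (_⇔_)
open import Data.Nat.Properties as ℕP using ()

Str : ℕ → Set
Str σ = List (Fin σ)

data _<lex_ {σ : ℕ} : Str σ → Str σ → Set where
  []<∷  : ∀ {y ys} → [] <lex (y ∷ ys)
  head< : ∀ {x y xs ys} → x Fin.< y → (x ∷ xs) <lex (y ∷ ys)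
  tail< : ∀ {x xs ys} → xs <lex ys → (x ∷ xs) <lex (x ∷ ys)

_≺_ : {σ : ℕ} → Str σ → Str σ → Set
α ≺ β = reverse α <lex reverse β

_⪯_ : {σ : ℕ} → Str σ → Str σ → Set
α ⪯ β = α ≡ β ⊎ α ≺ β

_⊣_ : {σ : ℕ} → Str σ → Str σ → Set
α ⊣ β = ∃ λ γ → γ ++ α ≡ β

StrictSuffix : {σ : ℕ} → Str σ → Str σ → Set
StrictSuffix α β = α ⊣ β × α ≢ β

pre : {σ : ℕ} → Str σ → ℕ → Str σ
pre α k = take k α

suf : {σ : ℕ} → Str σ → ℕ → Str σ
suf α k = drop (length α ∸ k) α

IsMax : (ℕ → Set) → ℕ → Set
IsMax P m = P m × (∀ m' → P m' → m' ≤ m)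

HasCard : {n : ℕ} → (Fin n → Set) → ℕ → Set
HasCard {n} P c = Σ (List (Fin n)) λ xs → Unique xs × length xs ≡ c × (∀ u → (u ∈ xs ⇔ P u))

Edge : ℕ → ℕ → Set
Edge σ n = Fin n × Fin n × Str σ

data Reach {σ n : ℕ} (E : List (Edge σ n)) : Fin n → Fin n → Set where
  here : ∀ {u} → Reach E u u
  step : ∀ {u v w ρ} → (u , v , ρ) ∈ E → Reach E v w → Reach E u w

data EWalk {σ n : ℕ} (E : List (Edge σ n)) : Fin n → Fin n → Set where
  here : ∀ {u} → EWalk E u u
  step : ∀ {u v w} → (u , v , []) ∈ E → EWalk E v w → EWalk E u w

record GNFA (σ n : ℕ) : Set₁ where
  field
    E      : List (Edge σ n)
    E-set  : Unique E
    s      : Fin n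
    F      : Fin n → Set
    reachable   : ∀ u → Reach E s u
    coreachable : ∀ u → F u ⊎ (∃ λ v → F v × Reach E u v)

module _ {σ n : ℕ} (A : GNFA σ n) where
  open GNFA A

  IsRGNFA : ℕ → Set
  IsRGNFA r = ∀ {u v ρ} → (u , v , ρ) ∈ E → length ρ ≤ r

  data I : Fin n → Str σ → Set where
    start : I s []
    step  : ∀ {u' u α ρ} → I u' α → (u' , u , ρ) ∈ E → I u (α ++ ρ)

  _⪯A_ : Fin n → Fin n → Set
  u ⪯A v = ∀ α β → I u α → I v β → ¬ (I v α × I u β) → α ≺ β

  Gprec : Str σ → Fin n → Set
  Gprec α u = ∀ β → I u β → β ≺ α

  -- A Wheeler order, given by a bijective rank function: Q[i] is the
  -- state of rank i-1 (1-based), and u ≤ v iff rank u ≤ rank v.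
  record WheelerOrder : Set where
    field
      rank     : Fin n → Fin n
      rank-inj : Injective _≡_ _≡_ rank
      w1 : ∀ u v → rank u Fin.≤ rank v → u ⪯A v
      w2 : ∀ u → rank s Fin.≤ rank u
      w3 : ∀ {u' u ρ v' v ρ'} → (u' , u , ρ) ∈ E → (v' , v , ρ') ∈ E →
           rank u Fin.< rank v → ¬ StrictSuffix ρ' ρ → ρ ⪯ ρ'
      w4 : ∀ {u' u v' v ρ} → (u' , u , ρ) ∈ E → (v' , v , ρ) ∈ E →
           rank u Fin.< rank v → rank u' Fin.≤ rank v'

  module _ (W : WheelerOrder) where
    open WheelerOrder W

    At : ℕ → Fin n → Set
    At i u = suc (toℕ (rank u)) ≡ i

    InPrefix : ℕ → Fin n → Set
    InPrefix j u = toℕ (rank u) < j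

    private
      inPrefix? : (j : ℕ) (u : Fin n) → Dec (InPrefix j u)
      inPrefix? j u = suc (toℕ (rank u)) ℕP.≤? j

      lbl? : (ρ ρ' : Str σ) → Dec (ρ' ≡ ρ)
      lbl? ρ ρ' = ≡-dec FinP._≟_ ρ' ρ

    outC : ℕ → Str σ → ℕ
    outC j ρ = length (filter (λ { (u , v , ρ') → inPrefix? j u ×-dec lbl? ρ ρ' }) E)

    inC : ℕ → Str σ → ℕ
    inC j ρ = length (filter (λ { (u , v , ρ') → inPrefix? j v ×-dec lbl? ρ ρ' }) E)

    AmaxIs : ℕ → ℕ → Set
    AmaxIs i m = IsMax (λ j → 1 ≤ j × j ≤ n ×
                   (∃ λ u → ∃ λ v → At j u × At i v × EWalk E u v)) m

    CondI : ℕ → Str σ → ℕ → Set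
    CondI r α j = ∀ k → 0 < k → k < suc r ℕ.⊓ length α →
                  ∀ c → HasCard (Gprec (pre α (length α ∸ k))) c →
                  inC j (suf α k) ≤ outC c (suf α k)

    CondII : ℕ → Str σ → ℕ → Set
    CondII r α j = ∀ h u → 1 ≤ h → h ≤ j → At h u →
                   ∀ k → 0 < k → k < suc r →
                   ∀ u' ρ → (u' , u , ρ) ∈ E → length ρ ≡ k → ρ ≺ α

    IsJStar : ℕ → Str σ → ℕ → Set
    IsJStar r α = IsMax (λ j → j ≤ n × CondI r α j × CondII r α j)

{-# OPTIONS --safe #-}
module Submission where

open import Level using (0ℓ)
open import Axiom.ExcludedMiddle using (ExcludedMiddle)
open import Data.Nat as ℕ using (ℕ; zero; suc; _≤_; _<_; _∸_; z≤n; s≤s; _⊓_)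
import Data.Nat.Properties as ℕP
open import Data.Fin using (Fin; toℕ; fromℕ<)
import Data.Fin.Properties as FinP
open import Data.List using (List; []; _∷_; _++_; length; reverse; take; drop; filter; map; upTo; allFin)
import Data.List.Properties as LP
open import Data.List.Membership.Propositional using (_∈_; _∉_)
open import Data.List.Membership.Propositional.Properties
  using (∈-map⁺; ∈-map⁻; ∈-upTo⁺; ∈-upTo⁻; ∈-allFin; ∈-filter⁺; ∈-filter⁻)
open import Data.List.Relation.Binary.Subset.Propositional using (_⊆_)
open import Data.List.Relation.Unary.Any using (here; there; _─_; index; any?)
import Data.List.Relation.Unary.All as All
open import Data.List.Relation.Unary.All.Properties using (¬Any⇒All¬)
open import Data.List.Relation.Unary.Unique.Propositional using (Unique)
import Data.List.Relation.Unary.Unique.Propositional.Properties as UniqueP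
open import Data.List.Relation.Unary.AllPairs using (_∷_)
open import Data.Product using (Σ; ∃; _×_; _,_; proj₁; proj₂)
open import Data.Sum using (_⊎_; inj₁; inj₂)
open import Data.Empty using (⊥-elim)
open import Function using (_∘_)
open import Function.Bundles using (mk⇔; Equivalence)
open import Relation.Binary.PropositionalEquality
  using (_≡_; _≢_; refl; sym; trans; cong; subst; subst₂; ≢-sym; module ≡-Reasoning)
open import Relation.Nullary using (¬_; yes; no)
open import Relation.Unary using (Pred; Decidable)
open import Defs

-- By Wheeler axiom (1), G^≺(α) is an initial segment Q[1,c] of the order,
-- c = |G^≺(α)|.  It satisfies (i), since an edge labelled s(α,k) entering
-- G^≺(α) leaves G^≺(p(α,|α|-k)), and (ii), so c ≤ j*; and an ε-walk into
-- G^≺(α) starts in G^≺(α), so A_max[c] = c.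
-- Conversely, let t ≤ j* with A_max[t] = t.  Every string of I_{Q[t]} is
-- read along an ε-walk into Q[t] starting at some Q[h] with h ≤ t, after
-- either the empty string or an edge into Q[h] with a non-empty label ρ.
-- By (ii) ρ ≺ α; when ρ is a proper suffix of α, (i) and axiom (4) force the
-- source of that edge into G^≺(p(α,|α|-|ρ|)).  Either way the string is ≺ α,
-- so Q[t] ∈ G^≺(α) and t ≤ c.

module _ {a} {A : Set a} where

  take-length-++ : (xs ys : List A) → take (length xs) (xs ++ ys) ≡ xs
  take-length-++ []       ys = refl
  take-length-++ (x ∷ xs) ys = cong (x ∷_) (take-length-++ xs ys)

  drop-length-++ : (xs ys : List A) → drop (length xs) (xs ++ ys) ≡ ys
  drop-length-++ []       ys = refl
  drop-length-++ (x ∷ xs) ys = drop-length-++ xs ys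

  length-++-∸ : (xs ys : List A) → length (xs ++ ys) ∸ length ys ≡ length xs
  length-++-∸ xs ys =
    trans (cong (_∸ length ys) (LP.length-++ xs)) (ℕP.m+n∸n≡m (length xs) (length ys))

  ≢[]⇒0<length : {xs : List A} → xs ≢ [] → 0 < length xs
  ≢[]⇒0<length {[]}    xs≢[] = ⊥-elim (xs≢[] refl)
  ≢[]⇒0<length {_ ∷ _} _     = s≤s z≤n

  ∈-─ : {x y : A} {xs : List A} (x∈xs : x ∈ xs) → y ∈ xs → y ≢ x → y ∈ (xs ─ x∈xs)
  ∈-─ (here refl) (here refl) y≢x = ⊥-elim (y≢x refl)
  ∈-─ (here refl) (there y∈)  _   = y∈
  ∈-─ (there _)   (here refl) _   = here refl
  ∈-─ (there x∈)  (there y∈)  y≢x = there (∈-─ x∈ y∈ y≢x)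

  Unique-⊆⇒length≤ : {xs ys : List A} → Unique xs → xs ⊆ ys → length xs ≤ length ys
  Unique-⊆⇒length≤ {[]}     _                _      = z≤n
  Unique-⊆⇒length≤ {x ∷ xs} {ys} (x∉xs ∷ uniq) x∷xs⊆ys =
    subst (suc (length xs) ≤_) (sym (LP.length-removeAt′ ys (index x∈ys)))
      (s≤s (Unique-⊆⇒length≤ uniq λ y∈xs →
        ∈-─ x∈ys (x∷xs⊆ys (there y∈xs)) (≢-sym (All.lookup x∉xs y∈xs))))
    where
    x∈ys : x ∈ ys
    x∈ys = x∷xs⊆ys (here refl)

  Unique-⊆⇒length< : {xs ys : List A} {y : A} → Unique xs → xs ⊆ ys → y ∈ ys → y ∉ xs →
                     length xs < length ys
  Unique-⊆⇒length< {xs} uniq xs⊆ys y∈ys y∉xs =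
    Unique-⊆⇒length≤ (¬Any⇒All¬ xs y∉xs ∷ uniq)
      λ { (here refl) → y∈ys ; (there z∈xs) → xs⊆ys z∈xs }

  module _ {p q} {P : Pred A p} {Q : Pred A q} (P? : Decidable P) (Q? : Decidable Q)
           {xs : List A} (uniq : Unique xs) (P⇒Q : ∀ {x} → x ∈ xs → P x → Q x) where

    filter-⊆ : filter P? xs ⊆ filter Q? xs
    filter-⊆ x∈ with ∈-filter⁻ P? {xs = xs} x∈
    ... | x∈xs , Px = ∈-filter⁺ Q? x∈xs (P⇒Q x∈xs Px)

    length-filter-mono : length (filter P? xs) ≤ length (filter Q? xs)
    length-filter-mono = Unique-⊆⇒length≤ (UniqueP.filter⁺ P? uniq) filter-⊆

    length-filter-mono-< : ∀ {x} → x ∈ xs → Q x → ¬ P x →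
                           length (filter P? xs) < length (filter Q? xs)
    length-filter-mono-< x∈xs Qx ¬Px =
      Unique-⊆⇒length< (UniqueP.filter⁺ P? uniq) filter-⊆ (∈-filter⁺ Q? x∈xs Qx)
        (¬Px ∘ proj₂ ∘ ∈-filter⁻ P? {xs = xs})

module _ {σ : ℕ} where

  <lex-trans : {a b c : Str σ} → a <lex b → b <lex c → a <lex c
  <lex-trans []<∷      (head< _) = []<∷
  <lex-trans []<∷      (tail< _) = []<∷
  <lex-trans (head< p) (head< q) = head< (FinP.<-trans p q)
  <lex-trans (head< p) (tail< _) = head< p
  <lex-trans (tail< _) (head< q) = head< q
  <lex-trans (tail< p) (tail< q) = tail< (<lex-trans p q)

  prefix-<lex : (a : Str σ) {b c : Str σ} → (a ++ b) <lex c → a <lex c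
  prefix-<lex []      {c = _ ∷ _} _ = []<∷
  prefix-<lex []      {[]}    {[]} ()
  prefix-<lex []      {_ ∷ _} {[]} ()
  prefix-<lex (x ∷ a) (head< p) = head< p
  prefix-<lex (x ∷ a) (tail< p) = tail< (prefix-<lex a p)

  <lex-cancelˡ : (a : Str σ) {b c : Str σ} → (a ++ b) <lex (a ++ c) → b <lex c
  <lex-cancelˡ []      p         = p
  <lex-cancelˡ (x ∷ a) (head< p) = ⊥-elim (FinP.<-irrefl refl p)
  <lex-cancelˡ (x ∷ a) (tail< p) = <lex-cancelˡ a p

  <lex-extendˡ : (a : Str σ) {b c : Str σ} → b <lex c → (a ++ b) <lex (a ++ c)
  <lex-extendˡ []      p = p
  <lex-extendˡ (x ∷ a) p = tail< (<lex-extendˡ a p)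

  <lex-split : {a c : Str σ} → a <lex c →
               (∃ λ d → d ≢ [] × a ++ d ≡ c) ⊎ (∀ b → (a ++ b) <lex c)
  <lex-split ([]<∷ {y} {ys}) = inj₁ (y ∷ ys , (λ ()) , refl)
  <lex-split (head< p)       = inj₂ λ _ → head< p
  <lex-split (tail< {x} p) with <lex-split p
  ... | inj₁ (d , d≢[] , eq) = inj₁ (d , d≢[] , cong (x ∷_) eq)
  ... | inj₂ below           = inj₂ λ b → tail< (below b)

  ≺-trans : {a b c : Str σ} → a ≺ b → b ≺ c → a ≺ c
  ≺-trans = <lex-trans

  suffix-≺ : (γ ρ α : Str σ) → (γ ++ ρ) ≺ α → ρ ≺ α
  suffix-≺ γ ρ α p = prefix-<lex (reverse ρ) (subst (_<lex reverse α) (LP.reverse-++ γ ρ) p)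

  ≺-cancelʳ : (γ P ρ : Str σ) → (γ ++ ρ) ≺ (P ++ ρ) → γ ≺ P
  ≺-cancelʳ γ P ρ p =
    <lex-cancelˡ (reverse ρ) (subst₂ _<lex_ (LP.reverse-++ γ ρ) (LP.reverse-++ P ρ) p)

  ≺-extendʳ : (γ P ρ : Str σ) → γ ≺ P → (γ ++ ρ) ≺ (P ++ ρ)
  ≺-extendʳ γ P ρ p =
    subst₂ _<lex_ (sym (LP.reverse-++ γ ρ)) (sym (LP.reverse-++ P ρ)) (<lex-extendˡ (reverse ρ) p)

  ≺-split : (ρ α : Str σ) → ρ ≺ α →
            (∃ λ P → P ≢ [] × P ++ ρ ≡ α) ⊎ (∀ γ → (γ ++ ρ) ≺ α)
  ≺-split ρ α p with <lex-split p
  ... | inj₂ below =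
    inj₂ λ γ → subst (_<lex reverse α) (sym (LP.reverse-++ γ ρ)) (below (reverse γ))
  ... | inj₁ (d , d≢[] , eq) = inj₁ (reverse d , d≢[] ∘ LP.reverse-injective , reverse-d++ρ≡α)
    where
    open ≡-Reasoning
    reverse-d++ρ≡α : reverse d ++ ρ ≡ α
    reverse-d++ρ≡α = begin
      reverse d ++ ρ                     ≡⟨ cong (reverse d ++_) (sym (LP.reverse-involutive ρ)) ⟩
      reverse d ++ reverse (reverse ρ)   ≡⟨ sym (LP.reverse-++ (reverse ρ) d) ⟩
      reverse (reverse ρ ++ d)           ≡⟨ cong reverse eq ⟩
      reverse (reverse α)                ≡⟨ LP.reverse-involutive α ⟩
      α                                  ∎

  []≺ : {α : Str σ} → α ≢ [] → [] ≺ α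
  []≺ {α} α≢[] with reverse α in eq
  ... | []    = ⊥-elim (α≢[] (LP.reverse-injective eq))
  ... | _ ∷ _ = []<∷

  pre-++ : (P ρ : Str σ) → pre (P ++ ρ) (length (P ++ ρ) ∸ length ρ) ≡ P
  pre-++ P ρ = trans (cong (λ m → take m (P ++ ρ)) (length-++-∸ P ρ)) (take-length-++ P ρ)

  suf-++ : (P ρ : Str σ) → suf (P ++ ρ) (length ρ) ≡ ρ
  suf-++ P ρ = trans (cong (λ m → drop m (P ++ ρ)) (length-++-∸ P ρ)) (drop-length-++ P ρ)

injective⇒surjective : {n : ℕ} {f : Fin n → Fin n} → (∀ {u v} → f u ≡ f v → u ≡ v) →
                       ∀ i → ∃ λ u → f u ≡ i
injective⇒surjective {n} {f} f-inj i with any? (i FinP.≟_) (map f (allFin n))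
... | yes i∈ with ∈-map⁻ f i∈
...   | u , _ , i≡fu = u , sym i≡fu
injective⇒surjective {n} {f} f-inj i | no i∉ =
  ⊥-elim (ℕP.<-irrefl length-image
    (Unique-⊆⇒length< image-unique (λ {j} _ → ∈-allFin j) (∈-allFin i) i∉))
  where
  image-unique : Unique (map f (allFin n))
  image-unique = UniqueP.map⁺ f-inj (UniqueP.allFin⁺ n)
  length-image : length (map f (allFin n)) ≡ length (allFin n)
  length-image = LP.length-map f (allFin n)

HasCard⇒≤ : {n c : ℕ} {P : Fin n → Set} → HasCard P c → c ≤ n
HasCard⇒≤ {n} (xs , uniq , refl , _) =
  subst (length xs ≤_) (LP.length-tabulate (λ i → i))
    (Unique-⊆⇒length≤ uniq (λ {i} _ → ∈-allFin i))

hasCard : ExcludedMiddle 0ℓ → {n : ℕ} (P : Fin n → Set) → ∃ (HasCard P)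
hasCard em {n} P = length xs , xs , UniqueP.filter⁺ P? (UniqueP.allFin⁺ n) , refl ,
  λ u → mk⇔ (proj₂ ∘ ∈-filter⁻ P? {xs = allFin n}) (∈-filter⁺ P? (∈-allFin u))
  where
  P? : Decidable P
  P? u = em
  xs : List (Fin n)
  xs = filter P? (allFin n)

module _ {σ n : ℕ} (A : GNFA σ n) where
  open GNFA A

  I-nonempty : ∀ u → ∃ (I A u)
  I-nonempty u = extend start (reachable u)
    where
    extend : ∀ {v w β} → I A v β → Reach E v w → ∃ (I A w)
    extend β∈ here        = _ , β∈
    extend β∈ (step e vw) = extend (step β∈ e) vw

  EWalk-I : ∀ {u v β} → EWalk E u v → I A u β → I A v β
  EWalk-I here                 β∈ = β∈
  EWalk-I {β = β} (step {v = w} e wv) β∈ =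
    EWalk-I wv (subst (I A w) (LP.++-identityʳ β) (step β∈ e))

  Gprec-EWalk : ∀ α {u v} → EWalk E u v → Gprec A α v → Gprec A α u
  Gprec-EWalk α uv v∈G β β∈ = v∈G β (EWalk-I uv β∈)

  Gprec-label : ∀ α {u' v ρ} → (u' , v , ρ) ∈ E → Gprec A α v → ρ ≺ α
  Gprec-label α {u'} {ρ = ρ} e v∈G with I-nonempty u'
  ... | γ , γ∈ = suffix-≺ γ ρ α (v∈G (γ ++ ρ) (step γ∈ e))

  Gprec-source : ∀ P {ρ u' v} → (u' , v , ρ) ∈ E → Gprec A (P ++ ρ) v → Gprec A P u'
  Gprec-source P {ρ} e v∈G γ γ∈ = ≺-cancelʳ γ P ρ (v∈G (γ ++ ρ) (step γ∈ e))

  module _ (W : WheelerOrder A) where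
    open WheelerOrder W

    rk : Fin n → ℕ
    rk u = toℕ (rank u)

    rk-injective : ∀ {u v} → rk u ≡ rk v → u ≡ v
    rk-injective = rank-inj ∘ FinP.toℕ-injective

    rk-surjective : ∀ {i} → i < n → ∃ λ u → rk u ≡ i
    rk-surjective {i} i<n with injective⇒surjective rank-inj (fromℕ< i<n)
    ... | u , rank-u = u , trans (cong toℕ rank-u) (FinP.toℕ-fromℕ< i<n)

    DownClosed : (Fin n → Set) → Set
    DownClosed P = ∀ {u v} → rk u ≤ rk v → P v → P u

    module _ {P : Fin n → Set} {c : ℕ} (P-down : DownClosed P) (P-card : HasCard P c) where
      private
        xs : List (Fin n)
        xs = proj₁ P-card
        xs-unique : Unique xs
        xs-unique = proj₁ (proj₂ P-card)
        length-xs : length (map rk xs) ≡ c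
        length-xs = trans (LP.length-map rk xs) (proj₁ (proj₂ (proj₂ P-card)))
        ∈xs⇒P : ∀ u → u ∈ xs → P u
        ∈xs⇒P u = Equivalence.to (proj₂ (proj₂ (proj₂ P-card)) u)
        P⇒∈xs : ∀ u → P u → u ∈ xs
        P⇒∈xs u = Equivalence.from (proj₂ (proj₂ (proj₂ P-card)) u)

      -- By down-closure and surjectivity of rk, the ranks 0, …, rk u all occur
      -- among the members of P.
      member⇒rank<card : ∀ {u} → P u → rk u < c
      member⇒rank<card {u} Pu =
        subst₂ _≤_ (LP.length-upTo (suc (rk u))) length-xs
          (Unique-⊆⇒length≤ (UniqueP.upTo⁺ (suc (rk u))) ranks≤u∈xs)
        where
        ranks≤u∈xs : upTo (suc (rk u)) ⊆ map rk xs
        ranks≤u∈xs i∈ = rank∈ (ℕ.s≤s⁻¹ (∈-upTo⁻ i∈))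
          where
          rank∈ : ∀ {i} → i ≤ rk u → i ∈ map rk xs
          rank∈ i≤u with v , refl ← rk-surjective (ℕP.≤-<-trans i≤u (FinP.toℕ<n (rank u)))
            = ∈-map⁺ rk (P⇒∈xs v (P-down i≤u Pu))

      -- If u ∉ P then all members of P have rank below rk u.
      rank<card⇒member : ∀ {u} → rk u < c → P u
      rank<card⇒member {u} u<c with any? (u FinP.≟_) xs
      ... | yes u∈xs = ∈xs⇒P u u∈xs
      ... | no u∉xs = ⊥-elim (ℕP.<⇒≱ u<c c≤u)
        where
        ranks∈below : map rk xs ⊆ upTo (rk u)
        ranks∈below i∈ with ∈-map⁻ rk i∈
        ... | v , v∈xs , refl with rk u ℕP.≤? rk v
        ...   | yes u≤v = ⊥-elim (u∉xs (P⇒∈xs u (P-down u≤v (∈xs⇒P v v∈xs))))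
        ...   | no u≰v  = ∈-upTo⁺ (ℕP.≰⇒> u≰v)
        c≤u : c ≤ rk u
        c≤u = subst₂ _≤_ length-xs (LP.length-upTo (rk u))
                (Unique-⊆⇒length≤ (UniqueP.map⁺ rk-injective xs-unique) ranks∈below)

    inC≤outC : ∀ {j c ρ} → (∀ {u' v} → (u' , v , ρ) ∈ E → rk v < j → rk u' < c) →
               inC A W j ρ ≤ outC A W c ρ
    inC≤outC enter⇒leave =
      length-filter-mono _ _ E-set λ { {_ , _ , _} e (v<j , refl) → enter⇒leave e v<j , refl }

    outC<inC : ∀ {j c ρ u' u} → (∀ {y v} → (y , v , ρ) ∈ E → rk y < c → rk v < j) →
               (u' , u , ρ) ∈ E → rk u < j → ¬ rk u' < c → outC A W c ρ < inC A W j ρ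
    outC<inC leave⇒enter e u<j u'≮c =
      length-filter-mono-< _ _ E-set (λ { {_ , _ , _} e′ (y<c , refl) → leave⇒enter e′ y<c , refl })
        e (u<j , refl) (λ { (u'<c , _) → u'≮c u'<c })

    -- If rk u' ≥ c, axiom (4) makes every ρ-edge leaving Q[1,c] enter Q[1,j],
    -- while e enters Q[1,j] without leaving Q[1,c]; so out < in.
    inC≤outC⇒source< : ∀ {j c ρ u' u} → inC A W j ρ ≤ outC A W c ρ →
                       (u' , u , ρ) ∈ E → rk u < j → rk u' < c
    inC≤outC⇒source< {j} {c} {ρ} {u'} in≤out e u<j with rk u' ℕP.<? c
    ... | yes u'<c = u'<c
    ... | no u'≮c  = ⊥-elim (ℕP.<⇒≱ (outC<inC leave⇒enter e u<j u'≮c) in≤out)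
      where
      leave⇒enter : ∀ {y v} → (y , v , ρ) ∈ E → rk y < c → rk v < j
      leave⇒enter {v = v} e′ y<c with rk v ℕP.<? j
      ... | yes v<j = v<j
      ... | no v≮j  =
        ⊥-elim (u'≮c (ℕP.≤-<-trans (w4 e e′ (ℕP.<-≤-trans u<j (ℕP.≮⇒≥ v≮j))) y<c))

    module _ (em : ExcludedMiddle 0ℓ) where

      -- A string β ∈ I_u ∖ I_v lies below every string of I_v by axiom (1).
      Gprec-downClosed : ∀ α → DownClosed (Gprec A α)
      Gprec-downClosed α {u} {v} u≤v v∈G β β∈Iu with I-nonempty v
      ... | γ , γ∈Iv with em {I A v β}
      ... | yes β∈Iv = v∈G β β∈Iv
      ... | no  β∉Iv =
        ≺-trans {a = β} {b = γ} {c = α}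
          (w1 u v u≤v β γ β∈Iu γ∈Iv (β∉Iv ∘ proj₁)) (v∈G γ γ∈Iv)

      CondI-Gprec : ∀ r α {c} → HasCard (Gprec A α) c → CondI A W r α c
      CondI-Gprec r α G-card k _ _ d P-card = inC≤outC λ e v<c →
        member⇒rank<card (Gprec-downClosed P) P-card
          (Gprec-source P e (subst (λ α′ → Gprec A α′ _) (sym α≡P++ρ)
            (rank<card⇒member (Gprec-downClosed α) G-card v<c)))
        where
        P : Str σ
        P = pre α (length α ∸ k)
        α≡P++ρ : P ++ suf α k ≡ α
        α≡P++ρ = LP.take++drop≡id (length α ∸ k) α

      CondII-Gprec : ∀ r α {c} → HasCard (Gprec A α) c → CondII A W r α c
      CondII-Gprec r α G-card _ _ _ u<c refl _ _ _ _ _ e _ =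
        Gprec-label α e (rank<card⇒member (Gprec-downClosed α) G-card u<c)

      AmaxIs-Gprec : ∀ α {c} → HasCard (Gprec A α) c → 1 ≤ c → AmaxIs A W c c
      AmaxIs-Gprec α {suc c} G-card (s≤s z≤n) with q , refl ← rk-surjective (HasCard⇒≤ G-card) =
        (s≤s z≤n , HasCard⇒≤ G-card , q , q , refl , refl , here) ,
        λ { _ (_ , _ , u , v , refl , v-at , uv) →
              member⇒rank<card G-down G-card
                (Gprec-EWalk α uv (rank<card⇒member G-down G-card (ℕP.≤-reflexive v-at))) }
        where
        G-down : DownClosed (Gprec A α)
        G-down = Gprec-downClosed α

      module _ {r : ℕ} (rg : IsRGNFA A r) where

        proper-suffix-source : ∀ {P ρ j u' u} → CondI A W r (P ++ ρ) j →
                               (u' , u , ρ) ∈ E → rk u < j → P ≢ [] → ρ ≢ [] → Gprec A P u'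
        proper-suffix-source {P} {ρ} {j} condI e u<j P≢[] ρ≢[]
          with c , P-card ← hasCard em (Gprec A P) =
          rank<card⇒member (Gprec-downClosed P) P-card (inC≤outC⇒source< in≤out e u<j)
          where
          |ρ|<bound : length ρ < suc r ⊓ length (P ++ ρ)
          |ρ|<bound = ℕP.⊓-glb (s≤s (rg e))
            (subst (length ρ <_) (sym (LP.length-++ P))
              (ℕP.+-monoˡ-≤ (length ρ) (≢[]⇒0<length P≢[])))
          in≤out : inC A W j ρ ≤ outC A W c ρ
          in≤out = subst (λ ρ′ → inC A W j ρ′ ≤ outC A W c ρ′) (suf-++ P ρ)
            (condI (length ρ) (≢[]⇒0<length ρ≢[]) |ρ|<bound c
              (subst (λ P′ → HasCard (Gprec A P′) c) (sym (pre-++ P ρ)) P-card))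

        edge-into-prefix-≺ : ∀ {α j u' u ρ γ} → CondI A W r α j → CondII A W r α j →
                             (u' , u , ρ) ∈ E → rk u < j → ρ ≢ [] → I A u' γ → (γ ++ ρ) ≺ α
        edge-into-prefix-≺ {α} {u = u} {ρ} {γ} condI condII e u<j ρ≢[] γ∈
          with ≺-split ρ α
                 (condII _ u (s≤s z≤n) u<j refl _ (≢[]⇒0<length ρ≢[]) (s≤s (rg e)) _ _ e refl)
        ... | inj₂ ρ-diverges       = ρ-diverges γ
        ... | inj₁ (P , P≢[] , refl) =
          ≺-extendʳ γ P ρ (proper-suffix-source condI e u<j P≢[] ρ≢[] γ γ∈)

        ε-predecessors-below⇒Gprec : ∀ {α j q} → α ≢ [] → CondI A W r α j → CondII A W r α j →
                                     (∀ {z} → EWalk E z q → rk z < j) → Gprec A α q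
        ε-predecessors-below⇒Gprec {α} {j} {q} α≢[] condI condII below _ β∈ = go β∈ here
          where
          go : ∀ {u β} → I A u β → EWalk E u q → β ≺ α
          go start _ = []≺ α≢[]
          go (step {α = β} {ρ = []} β∈ e) uq =
            subst (_≺ α) (sym (LP.++-identityʳ β)) (go β∈ (step e uq))
          go (step {ρ = _ ∷ _} β∈ e) uq =
            edge-into-prefix-≺ condI condII e (below uq) (λ ()) β∈

        AmaxIs⇒≤card : ∀ {α j c t} → α ≢ [] → CondI A W r α j → CondII A W r α j →
                       HasCard (Gprec A α) c → t ≤ j → AmaxIs A W t t → t ≤ c
        AmaxIs⇒≤card {α} {j} α≢[] condI condII G-card t≤j ((_ , _ , _ , q , _ , refl , _) , t-max) =
          member⇒rank<card (Gprec-downClosed α) G-card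
            (ε-predecessors-below⇒Gprec α≢[] condI condII below)
          where
          below : ∀ {z} → EWalk E z q → rk z < j
          below {z} zq = ℕP.≤-trans
            (t-max (suc (rk z)) (s≤s z≤n , FinP.toℕ<n (rank z) , z , q , refl , refl , zq)) t≤j

lemma4 : ExcludedMiddle 0ℓ →
    ∀ {σ n : ℕ} (A : GNFA σ n) (r : ℕ) → IsRGNFA A r →
    (W : WheelerOrder A) →
    (α : Str σ) → α ≢ [] →
    (jstar : ℕ) → IsJStar A W r α jstar →
    Σ ℕ (λ c → HasCard (Gprec A α) c ×
      IsMax (λ t → t ≤ jstar × (1 ≤ t → AmaxIs A W t t)) c)
lemma4 em A r rg W α α≢[] jstar ((_ , condI , condII) , jstar-max)
  with c , G-card ← hasCard em (Gprec A α) =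
  c , G-card , (c≤jstar , AmaxIs-Gprec A W em α G-card) , fixpoints≤c
  where
  c≤jstar : c ≤ jstar
  c≤jstar = jstar-max c
    (HasCard⇒≤ G-card , CondI-Gprec A W em r α G-card , CondII-Gprec A W em r α G-card)
  fixpoints≤c : ∀ t → t ≤ jstar × (1 ≤ t → AmaxIs A W t t) → t ≤ c
  fixpoints≤c zero    _            = z≤n
  fixpoints≤c (suc t) (t≤j , amax) =
    AmaxIs⇒≤card A W em rg α≢[] condI condII G-card t≤j (amax (s≤s z≤n))
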